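{- Let $M$ be a multisymmetric matroid on $\widetilde E=\widetilde E_1\sqcup\cdots\sqcup\widetilde E_n$. (1) If $S\subseteq\widetilde E$, then for each $i$, either $\mathrm{cl}_M(S)\cap\widetilde E_i=\widetilde E_i$ or $\mathrm{cl}_M(S)\cap\widetilde E_i=S\cap\widetilde E_i$. (2) If $F$ is a flat of $M$, then $\mathrm{rk}_M(F)=\mathrm{rk}_M(F^{\mathrm{geo}})+|F\setminus F^{\mathrm{geo}}|$.
   Context: All matroids are loopless. Flats of a matroid are subsets maximal among sets of their rank; $\mathrm{cl}_M(S)$ is the smallest flat containing $S$. A multisymmetric matroid is a matroid $M$ on $\widetilde E$ with a partition $\widetilde E=\widetilde E_1\sqcup\cdots\sqcup\widetilde E_n$ such that $\Gamma=\mathfrak S_{\widetilde E_1}\times\cdots\times\mathfrak S_{\widetilde E_n}$ maps flats to flats. The geometric part of $S\subseteq\widetilde E$ is $S^{\mathrm{geo}}=\bigcap_{\gamma\in\Gamma}\gamma\cdot S$. -}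

module Defs where

open import Data.Nat using (ℕ; _≤_; _+_; _<_)
open import Data.Fin using (Fin; _≟_)
open import Data.Fin.Subset using (Subset; _∈_; _⊆_; _∩_; _∪_; _─_; ∣_∣; ⁅_⁆)
open import Data.Fin.Permutation using (Permutation′; _⟨$⟩ʳ_; _⟨$⟩ˡ_)
open import Data.Vec using (tabulate; lookup)
open import Data.Product using (_×_)
open import Relation.Binary.PropositionalEquality using (_≡_)
open import Relation.Nullary.Decidable using (⌊_⌋)

record Matroid (m : ℕ) : Set where
  field
    rk        : Subset m → ℕ
    rk-bound  : ∀ X → rk X ≤ ∣ X ∣
    rk-mono   : ∀ X Y → X ⊆ Y → rk X ≤ rk Y
    rk-submod : ∀ X Y → rk (X ∪ Y) + rk (X ∩ Y) ≤ rk X + rk Y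
    loopless  : ∀ e → rk ⁅ e ⁆ ≡ 1
open Matroid public

IsFlat : ∀ {m} → Matroid m → Subset m → Set
IsFlat M F = ∀ G → F ⊆ G → rk M G ≡ rk M F → G ≡ F

IsClosure : ∀ {m} → Matroid m → Subset m → Subset m → Set
IsClosure M S C = IsFlat M C × S ⊆ C × (∀ F → IsFlat M F → S ⊆ F → C ⊆ F)

Block : ∀ {m n} → (Fin m → Fin n) → Fin n → Subset m
Block block i = tabulate (λ e → ⌊ block e ≟ i ⌋)

-- Γ = product of symmetric groups of the blocks: block-preserving permutations.
InΓ : ∀ {m n} → (Fin m → Fin n) → Permutation′ m → Set
InΓ block γ = ∀ e → block (γ ⟨$⟩ʳ e) ≡ block e

-- γ · S = image of S under γ  (e ∈ γ·S iff γ⁻¹ e ∈ S).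
act : ∀ {m} → Permutation′ m → Subset m → Subset m
act γ S = tabulate (λ e → lookup S (γ ⟨$⟩ˡ e))

IsMultisymmetric : ∀ {m n} → Matroid m → (Fin m → Fin n) → Set
IsMultisymmetric M block =
  ∀ γ → InΓ block γ → ∀ F → IsFlat M F → IsFlat M (act γ F)

-- G = S^geo = ⋂_{γ ∈ Γ} γ · S.
IsGeoPart : ∀ {m n} → (Fin m → Fin n) → Subset m → Subset m → Set
IsGeoPart block S G = ∀ e → (e ∈ G → ∀ γ → InΓ block γ → e ∈ act γ S)
                          × ((∀ γ → InΓ block γ → e ∈ act γ S) → e ∈ G)

-- Every transposition (x f) of two elements of one block lies in Γ, so it maps flats to flats.
-- (1) If x ∈ cl(S) ∖ S and f ∉ cl(S) lie in the same block, then (x f) fixes S pointwise, so the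
-- flat (x f)·cl(S) contains S and hence cl(S) ∋ x; thus f = (x f)⁻¹ x ∈ cl(S), a contradiction.
-- (2) If e ∈ F ∖ F^geo, some f in the block of e lies outside F, and then F ∩ (e f)·F = F − e is
-- a flat; so every element of F ∖ F^geo is a coloop of M|F, and adding these coloops to F^geo one
-- at a time raises the rank by one each time.

module Submission where

open import Defs
open import Data.Nat using (zero; suc; _+_; _≤_; _<_)
open import Data.Nat.Properties
  using (≤-antisym; +-monoʳ-≤; +-mono-≤; +-cancelʳ-≤; +-comm; +-suc; +-identityʳ;
         ≤∧≢⇒<; m≤m+n; suc-injective; 0≢1+n; module ≤-Reasoning)
open import Data.Bool using (Bool; true)
open import Data.Fin using (Fin; _≟_)
open import Data.Fin.Properties using (any?)
open import Data.Fin.Subset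
  using (Subset; inside; outside; _∈_; _∉_; _⊆_; _∩_; _∪_; _─_; _-_; ⁅_⁆; ∣_∣; ⊥)
open import Data.Fin.Subset.Properties
  using (_∈?_; x∈⁅x⁆; x∈⁅y⁆⇒x≡y; p⊆p∪q; q⊆p∪q; x∈p∪q⁺; x∈p∪q⁻; p∩q⊆p; p∩q⊆q;
         x∈p∩q⁺; x∈p∩q⁻; p─q⊆p; x∈p∧x∉q⇒x∈p─q; x∈p∧x≢y⇒x∈p-y; p─⊥≡p; ⊆-antisym;
         nonempty?; Empty-unique; ∣⊥∣≡0; ∪-assoc; ∪-identityʳ)
open import Data.Fin.Permutation using (Permutation′; _⟨$⟩ˡ_; id; transpose; inverseʳ)
import Data.Fin.Permutation.Components as PC
open import Data.Vec using (_∷_; tabulate; lookup)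
open import Data.Vec.Properties using (lookup∘tabulate; []=⇒lookup; lookup⇒[]=)
open import Data.Vec.Base using (here; there)
open import Data.Product using (∃; _×_; _,_; proj₁; proj₂)
open import Data.Sum using (_⊎_; inj₁; inj₂)
open import Data.Empty using (⊥-elim)
open import Function using (_∘_)
open import Relation.Nullary using (¬_; yes; no; ¬?; contradiction)
open import Relation.Nullary.Decidable using (⌊_⌋; _×-dec_; decidable-stable)
open import Relation.Binary.PropositionalEquality
  using (_≡_; _≢_; refl; sym; trans; cong; subst; module ≡-Reasoning)

∈-tabulate⁺ : ∀ {m} (f : Fin m → Bool) {x} → f x ≡ true → x ∈ tabulate f
∈-tabulate⁺ f {x} fx = lookup⇒[]= x (tabulate f) (trans (lookup∘tabulate f x) fx)

∈-tabulate⁻ : ∀ {m} (f : Fin m → Bool) {x} → x ∈ tabulate f → f x ≡ true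
∈-tabulate⁻ f {x} x∈ = trans (sym (lookup∘tabulate f x)) ([]=⇒lookup x∈)

x∈p─q⇒x∉q : ∀ {n} {p q : Subset n} {x} → x ∈ p ─ q → x ∉ q
x∈p─q⇒x∉q {p = _ ∷ _} {inside  ∷ _} {Fin.zero} () _
x∈p─q⇒x∉q {p = _ ∷ _} {outside ∷ _} {Fin.zero} _ ()
x∈p─q⇒x∉q {p = _ ∷ _} {_ ∷ _} {Fin.suc x} (there x∈) (there x∈q) = x∈p─q⇒x∉q x∈ x∈q

x∈p⇒∣p∣≡1+∣p-x∣ : ∀ {n} {p : Subset n} {x} → x ∈ p → ∣ p ∣ ≡ suc ∣ p - x ∣
x∈p⇒∣p∣≡1+∣p-x∣ {p = inside  ∷ p} here        = cong (suc ∘ ∣_∣) (sym (p─⊥≡p p))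
x∈p⇒∣p∣≡1+∣p-x∣ {p = inside  ∷ p} (there x∈p) = cong suc (x∈p⇒∣p∣≡1+∣p-x∣ x∈p)
x∈p⇒∣p∣≡1+∣p-x∣ {p = outside ∷ p} (there x∈p) = x∈p⇒∣p∣≡1+∣p-x∣ x∈p

∣p∣≡0⇒p≡⊥ : ∀ {n} {p : Subset n} → ∣ p ∣ ≡ 0 → p ≡ ⊥
∣p∣≡0⇒p≡⊥ ∣p∣≡0 = Empty-unique λ (x , x∈p) → 0≢1+n (trans (sym ∣p∣≡0) (x∈p⇒∣p∣≡1+∣p-x∣ x∈p))

∪-least : ∀ {n} {p q r : Subset n} → p ⊆ r → q ⊆ r → p ∪ q ⊆ r
∪-least {p = p} {q} p⊆r q⊆r x∈ with x∈p∪q⁻ p q x∈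
... | inj₁ x∈p = p⊆r x∈p
... | inj₂ x∈q = q⊆r x∈q

x∈p⇒⁅x⁆⊆p : ∀ {n} {p : Subset n} {x} → x ∈ p → ⁅ x ⁆ ⊆ p
x∈p⇒⁅x⁆⊆p {p = p} {x} x∈p y∈⁅x⁆ = subst (_∈ p) (sym (x∈⁅y⁆⇒x≡y x y∈⁅x⁆)) x∈p

p⊆⁅x⁆∪p-x : ∀ {n} (p : Subset n) x → p ⊆ ⁅ x ⁆ ∪ (p - x)
p⊆⁅x⁆∪p-x p x {y} y∈p with y ≟ x
... | yes refl = x∈p∪q⁺ (inj₁ (x∈⁅x⁆ x))
... | no y≢x   = x∈p∪q⁺ (inj₂ (x∈p∧x≢y⇒x∈p-y y∈p y≢x))

x∈p⇒p≡⁅x⁆∪p-x : ∀ {n} {p : Subset n} {x} → x ∈ p → p ≡ ⁅ x ⁆ ∪ (p - x)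
x∈p⇒p≡⁅x⁆∪p-x {p = p} {x} x∈p =
  ⊆-antisym (p⊆⁅x⁆∪p-x p x) (∪-least (x∈p⇒⁅x⁆⊆p x∈p) (p─q⊆p p ⁅ x ⁆))

p⊆q⇒q≡p∪q─p : ∀ {n} {p q : Subset n} → p ⊆ q → q ≡ p ∪ (q ─ p)
p⊆q⇒q≡p∪q─p {p = p} {q} p⊆q = ⊆-antisym q⊆ (∪-least p⊆q (p─q⊆p q p))
  where
  q⊆ : q ⊆ p ∪ (q ─ p)
  q⊆ {x} x∈q with x ∈? p
  ... | yes x∈p = x∈p∪q⁺ (inj₁ x∈p)
  ... | no  x∉p = x∈p∪q⁺ (inj₂ (x∈p∧x∉q⇒x∈p─q x∈q x∉p))

transpose-second : ∀ {m} (i j : Fin m) → PC.transpose i j j ≡ i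
transpose-second i j with j ≟ i
... | yes j≡i = j≡i
... | no  _ with j ≟ j
...   | yes _   = refl
...   | no  j≢j = contradiction refl j≢j

transpose-other : ∀ {m} {i j k : Fin m} → k ≢ i → k ≢ j → PC.transpose i j k ≡ k
transpose-other {i = i} {j} {k} k≢i k≢j with k ≟ i
... | yes k≡i = contradiction k≡i k≢i
... | no  _ with k ≟ j
...   | yes k≡j = contradiction k≡j k≢j
...   | no  _   = refl

transpose-InΓ : ∀ {m n} (block : Fin m → Fin n) {i j} → block i ≡ block j →
                InΓ block (transpose i j)
transpose-InΓ block {i} {j} bi≡bj k with k ≟ i
... | yes refl = sym bi≡bj
... | no  _ with k ≟ j
...   | yes refl = bi≡bj
...   | no  _    = refl

∈-act⁺ : ∀ {m} (γ : Permutation′ m) {A : Subset m} {x} → γ ⟨$⟩ˡ x ∈ A → x ∈ act γ A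
∈-act⁺ γ {A} x∈ = ∈-tabulate⁺ (λ e → lookup A (γ ⟨$⟩ˡ e)) ([]=⇒lookup x∈)

∈-act⁻ : ∀ {m} (γ : Permutation′ m) {A : Subset m} {x} → x ∈ act γ A → γ ⟨$⟩ˡ x ∈ A
∈-act⁻ γ {A} x∈ = lookup⇒[]= _ A (∈-tabulate⁻ (λ e → lookup A (γ ⟨$⟩ˡ e)) x∈)

∈-act-transpose : ∀ {m} {A : Subset m} {a b x} → x ≢ a → x ≢ b → x ∈ A →
                  x ∈ act (transpose a b) A
∈-act-transpose {A = A} x≢a x≢b x∈A =
  ∈-act⁺ (transpose _ _) (subst (_∈ A) (sym (transpose-other x≢b x≢a)) x∈A)

∈-act-transpose⁻ : ∀ {m} {A : Subset m} {a b} → a ∈ act (transpose a b) A → b ∈ A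
∈-act-transpose⁻ {A = A} {a} {b} a∈ =
  subst (_∈ A) (transpose-second b a) (∈-act⁻ (transpose a b) a∈)

∈-Block⁻ : ∀ {m n} (block : Fin m → Fin n) {i x} → x ∈ Block block i → block x ≡ i
∈-Block⁻ block {i} {x} x∈ with block x ≟ i | ∈-tabulate⁻ (λ e → ⌊ block e ≟ i ⌋) {x} x∈
... | yes bx≡i | _  = bx≡i
... | no  _    | ()

IsColoop : ∀ {m} → Matroid m → Subset m → Fin m → Set
IsColoop M F e = e ∈ F × rk M (F - e) < rk M F

module _ {m} (M : Matroid m) where

  rk-∪⁅⁆≤ : ∀ Z e → rk M (Z ∪ ⁅ e ⁆) ≤ suc (rk M Z)
  rk-∪⁅⁆≤ Z e = begin
    rk M (Z ∪ ⁅ e ⁆)                        ≤⟨ m≤m+n _ _ ⟩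
    rk M (Z ∪ ⁅ e ⁆) + rk M (Z ∩ ⁅ e ⁆)     ≤⟨ rk-submod M Z ⁅ e ⁆ ⟩
    rk M Z + rk M ⁅ e ⁆                      ≡⟨ cong (rk M Z +_) (loopless M e) ⟩
    rk M Z + 1                               ≡⟨ +-comm (rk M Z) 1 ⟩
    suc (rk M Z)                             ∎
    where open ≤-Reasoning

  isFlat-absorbs : ∀ {F H x} → IsFlat M F → H ⊆ F → rk M (H ∪ ⁅ x ⁆) ≤ rk M H → x ∈ F
  isFlat-absorbs {F} {H} {x} F-flat H⊆F rk-H+x≤ =
    subst (x ∈_) G≡F (q⊆p∪q F (H ∪ ⁅ x ⁆) (q⊆p∪q H ⁅ x ⁆ (x∈⁅x⁆ x)))
    where
    open ≤-Reasoning
    G : Subset m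
    G = F ∪ (H ∪ ⁅ x ⁆)
    rk-G≤rk-F : rk M G ≤ rk M F
    rk-G≤rk-F = +-cancelʳ-≤ (rk M H) _ _ (begin
      rk M G + rk M H                           ≤⟨ +-monoʳ-≤ (rk M G) (rk-mono M _ _
                                                     (λ h → x∈p∩q⁺ (H⊆F h , p⊆p∪q ⁅ x ⁆ h))) ⟩
      rk M G + rk M (F ∩ (H ∪ ⁅ x ⁆))           ≤⟨ rk-submod M F (H ∪ ⁅ x ⁆) ⟩
      rk M F + rk M (H ∪ ⁅ x ⁆)                 ≤⟨ +-monoʳ-≤ (rk M F) rk-H+x≤ ⟩
      rk M F + rk M H                           ∎)
    G≡F : G ≡ F
    G≡F = F-flat G (p⊆p∪q _) (≤-antisym rk-G≤rk-F (rk-mono M _ _ (p⊆p∪q _)))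

  ∩-isFlat : ∀ {F₁ F₂} → IsFlat M F₁ → IsFlat M F₂ → IsFlat M (F₁ ∩ F₂)
  ∩-isFlat {F₁} {F₂} flat₁ flat₂ K H⊆K rk-K≡rk-H = ⊆-antisym K⊆H H⊆K
    where
    H : Subset m
    H = F₁ ∩ F₂
    K⊆H : K ⊆ H
    K⊆H {x} x∈K = x∈p∩q⁺ (isFlat-absorbs flat₁ (p∩q⊆p F₁ F₂) rk-H+x≤ ,
                          isFlat-absorbs flat₂ (p∩q⊆q F₁ F₂) rk-H+x≤)
      where
      rk-H+x≤ : rk M (H ∪ ⁅ x ⁆) ≤ rk M H
      rk-H+x≤ = subst (rk M (H ∪ ⁅ x ⁆) ≤_) rk-K≡rk-H
                  (rk-mono M _ _ (∪-least H⊆K (x∈p⇒⁅x⁆⊆p x∈K)))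

  isFlat-remove⇒isColoop : ∀ {F e} → IsFlat M (F - e) → e ∈ F → IsColoop M F e
  isFlat-remove⇒isColoop {F} {e} F-e-flat e∈F =
    e∈F , ≤∧≢⇒< (rk-mono M _ _ (p─q⊆p F ⁅ e ⁆)) rk-F-e≢rk-F
    where
    rk-F-e≢rk-F : rk M (F - e) ≢ rk M F
    rk-F-e≢rk-F eq = x∈p─q⇒x∉q (subst (e ∈_) (F-e-flat F (p─q⊆p F ⁅ e ⁆) (sym eq)) e∈F)
                                (x∈⁅x⁆ e)

  isColoop-rk-∪⁅⁆ : ∀ {F e Z} → IsColoop M F e → Z ⊆ F → e ∉ Z →
                    rk M (Z ∪ ⁅ e ⁆) ≡ suc (rk M Z)
  isColoop-rk-∪⁅⁆ {F} {e} {Z} (e∈F , rk-F-e<rk-F) Z⊆F e∉Z =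
    ≤-antisym (rk-∪⁅⁆≤ Z e) (+-cancelʳ-≤ (rk M (F - e)) _ _ (begin
      suc (rk M Z) + rk M (F - e)                 ≡⟨ +-suc (rk M Z) (rk M (F - e)) ⟨
      rk M Z + suc (rk M (F - e))                 ≤⟨ +-monoʳ-≤ (rk M Z) rk-F-e<rk-F ⟩
      rk M Z + rk M F                             ≡⟨ +-comm (rk M Z) (rk M F) ⟩
      rk M F + rk M Z                             ≤⟨ +-mono-≤ (rk-mono M _ _ F⊆) (rk-mono M _ _ Z⊆) ⟩
      rk M ((Z ∪ ⁅ e ⁆) ∪ (F - e)) + rk M ((Z ∪ ⁅ e ⁆) ∩ (F - e))
                                                  ≤⟨ rk-submod M (Z ∪ ⁅ e ⁆) (F - e) ⟩
      rk M (Z ∪ ⁅ e ⁆) + rk M (F - e)             ∎))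
    where
    open ≤-Reasoning
    F⊆ : F ⊆ (Z ∪ ⁅ e ⁆) ∪ (F - e)
    F⊆ x∈F with x∈p∪q⁻ ⁅ e ⁆ (F - e) (p⊆⁅x⁆∪p-x F e x∈F)
    ... | inj₁ x∈⁅e⁆ = p⊆p∪q (F - e) (q⊆p∪q Z ⁅ e ⁆ x∈⁅e⁆)
    ... | inj₂ x∈F-e = q⊆p∪q (Z ∪ ⁅ e ⁆) (F - e) x∈F-e
    Z⊆ : Z ⊆ (Z ∪ ⁅ e ⁆) ∩ (F - e)
    Z⊆ {x} x∈Z = x∈p∩q⁺ (p⊆p∪q ⁅ e ⁆ x∈Z ,
                         x∈p∧x≢y⇒x∈p-y (Z⊆F x∈Z) (λ { refl → e∉Z x∈Z }))

  isColoops-rk-∪ : ∀ {F Z Y} → Z ⊆ F → (∀ {e} → e ∈ Y → IsColoop M F e) →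
                   (∀ {e} → e ∈ Y → e ∉ Z) → rk M (Z ∪ Y) ≡ rk M Z + ∣ Y ∣
  isColoops-rk-∪ = go _ refl
    where
    open ≡-Reasoning
    go : ∀ k {F Z Y} → ∣ Y ∣ ≡ k → Z ⊆ F → (∀ {e} → e ∈ Y → IsColoop M F e) →
         (∀ {e} → e ∈ Y → e ∉ Z) → rk M (Z ∪ Y) ≡ rk M Z + k
    go zero {Z = Z} {Y} ∣Y∣≡0 _ _ _ = begin
      rk M (Z ∪ Y)    ≡⟨ cong (λ W → rk M (Z ∪ W)) (∣p∣≡0⇒p≡⊥ ∣Y∣≡0) ⟩
      rk M (Z ∪ ⊥)    ≡⟨ cong (rk M) (∪-identityʳ Z) ⟩
      rk M Z          ≡⟨ +-identityʳ (rk M Z) ⟨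
      rk M Z + 0      ∎
    go (suc k) {F} {Z} {Y} ∣Y∣≡1+k Z⊆F Y-coloops Y-disjoint-Z with nonempty? Y
    ... | no Y-empty =
      ⊥-elim (0≢1+n (trans (sym (trans (cong ∣_∣ (Empty-unique Y-empty)) (∣⊥∣≡0 m))) ∣Y∣≡1+k))
    ... | yes (x , x∈Y) = begin
      rk M (Z ∪ Y)                    ≡⟨ cong (λ W → rk M (Z ∪ W)) (x∈p⇒p≡⁅x⁆∪p-x x∈Y) ⟩
      rk M (Z ∪ (⁅ x ⁆ ∪ (Y - x)))    ≡⟨ cong (rk M) (∪-assoc Z ⁅ x ⁆ (Y - x)) ⟨
      rk M ((Z ∪ ⁅ x ⁆) ∪ (Y - x))    ≡⟨ go k ∣Y-x∣≡k Z+x⊆F (Y-coloops ∘ Y-x⊆Y) Y-x-disjoint-Z+x ⟩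
      rk M (Z ∪ ⁅ x ⁆) + k            ≡⟨ cong (_+ k) (isColoop-rk-∪⁅⁆ x-coloop Z⊆F (Y-disjoint-Z x∈Y)) ⟩
      suc (rk M Z) + k                ≡⟨ +-suc (rk M Z) k ⟨
      rk M Z + suc k                  ∎
      where
      x-coloop : IsColoop M F x
      x-coloop = Y-coloops x∈Y
      Y-x⊆Y : Y - x ⊆ Y
      Y-x⊆Y = p─q⊆p Y ⁅ x ⁆
      ∣Y-x∣≡k : ∣ Y - x ∣ ≡ k
      ∣Y-x∣≡k = suc-injective (trans (sym (x∈p⇒∣p∣≡1+∣p-x∣ x∈Y)) ∣Y∣≡1+k)
      Z+x⊆F : Z ∪ ⁅ x ⁆ ⊆ F
      Z+x⊆F = ∪-least Z⊆F (x∈p⇒⁅x⁆⊆p (proj₁ x-coloop))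
      Y-x-disjoint-Z+x : ∀ {e} → e ∈ Y - x → e ∉ Z ∪ ⁅ x ⁆
      Y-x-disjoint-Z+x e∈Y-x e∈Z+x with x∈p∪q⁻ Z ⁅ x ⁆ e∈Z+x
      ... | inj₁ e∈Z   = Y-disjoint-Z (Y-x⊆Y e∈Y-x) e∈Z
      ... | inj₂ e∈⁅x⁆ = x∈p─q⇒x∉q e∈Y-x e∈⁅x⁆

∩-act-transpose : ∀ {m} {A : Subset m} {a b} → a ∈ A → b ∉ A →
                  A ∩ act (transpose a b) A ≡ A - a
∩-act-transpose {A = A} {a} {b} a∈A b∉A = ⊆-antisym ⊆A-a A-a⊆
  where
  ⊆A-a : A ∩ act (transpose a b) A ⊆ A - a
  ⊆A-a x∈ with x∈p∩q⁻ A _ x∈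
  ... | x∈A , x∈γA = x∈p∧x≢y⇒x∈p-y x∈A (λ { refl → b∉A (∈-act-transpose⁻ x∈γA) })
  A-a⊆ : A - a ⊆ A ∩ act (transpose a b) A
  A-a⊆ {x} x∈A-a = x∈p∩q⁺ (x∈A , ∈-act-transpose x≢a (λ { refl → b∉A x∈A }) x∈A)
    where
    x∈A : x ∈ A
    x∈A = p─q⊆p A ⁅ a ⁆ x∈A-a
    x≢a : x ≢ a
    x≢a = λ { refl → x∈p─q⇒x∉q x∈A-a (x∈⁅x⁆ a) }

module _ {m n} {block : Fin m → Fin n} where

  geo⊆ : ∀ {F G} → IsGeoPart block F G → G ⊆ F
  geo⊆ {F} geo {e} e∈G = ∈-act⁻ id (proj₁ (geo e) e∈G id (λ _ → refl))

  ∉geo⇒∃∉-in-block : ∀ {F G e} → IsGeoPart block F G → e ∉ G →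
                       ∃ λ f → block f ≡ block e × f ∉ F
  ∉geo⇒∃∉-in-block {F} {G} {e} geo e∉G
    with any? (λ f → (block f ≟ block e) ×-dec ¬? (f ∈? F))
  ... | yes mate   = mate
  ... | no  ∄mate = ⊥-elim (e∉G (proj₂ (geo e) e∈ΓF))
    where
    e∈ΓF : ∀ γ → InΓ block γ → e ∈ act γ F
    e∈ΓF γ γ∈Γ = ∈-act⁺ γ (decidable-stable (γ ⟨$⟩ˡ e ∈? F) λ γ⁻¹e∉F → ∄mate (_ , b-γ⁻¹e , γ⁻¹e∉F))
      where
      b-γ⁻¹e : block (γ ⟨$⟩ˡ e) ≡ block e
      b-γ⁻¹e = trans (sym (γ∈Γ (γ ⟨$⟩ˡ e))) (cong block (inverseʳ γ))

module _ {m n} (M : Matroid m) (block : Fin m → Fin n) (multisym : IsMultisymmetric M block) where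

  closure-saturates-block : ∀ {S C x f} → IsClosure M S C → x ∈ C → x ∉ S →
                            block f ≡ block x → f ∈ C
  closure-saturates-block {S} {C} {x} {f} (C-flat , S⊆C , C-least) x∈C x∉S bf≡bx =
    decidable-stable (f ∈? C) λ f∉C →
      f∉C (∈-act-transpose⁻ (C-least (act γ C) γC-flat (S⊆γC f∉C) x∈C))
    where
    γ : Permutation′ m
    γ = transpose x f
    γC-flat : IsFlat M (act γ C)
    γC-flat = multisym γ (transpose-InΓ block (sym bf≡bx)) C C-flat
    S⊆γC : f ∉ C → S ⊆ act γ C
    S⊆γC f∉C s∈S = ∈-act-transpose (λ { refl → x∉S s∈S }) (λ { refl → f∉C (S⊆C s∈S) }) (S⊆C s∈S)

  closure-∩-Block : ∀ S C → IsClosure M S C → ∀ i →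
    (C ∩ Block block i ≡ Block block i) ⊎ (C ∩ Block block i ≡ S ∩ Block block i)
  closure-∩-Block S C cl@(_ , S⊆C , _) i
    with any? (λ f → (f ∈? Block block i) ×-dec ¬? (f ∈? C))
  ... | no ∄f∉C = inj₁ (⊆-antisym (p∩q⊆q C _) B⊆C∩B)
    where
    B⊆C∩B : Block block i ⊆ C ∩ Block block i
    B⊆C∩B x∈B = x∈p∩q⁺ (decidable-stable (_ ∈? C) (λ x∉C → ∄f∉C (_ , x∈B , x∉C)) , x∈B)
  ... | yes (f , f∈B , f∉C) = inj₂ (⊆-antisym C∩B⊆S∩B S∩B⊆C∩B)
    where
    S∩B⊆C∩B : S ∩ Block block i ⊆ C ∩ Block block i
    S∩B⊆C∩B x∈ with x∈p∩q⁻ S _ x∈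
    ... | x∈S , x∈B = x∈p∩q⁺ (S⊆C x∈S , x∈B)
    C∩B⊆S∩B : C ∩ Block block i ⊆ S ∩ Block block i
    C∩B⊆S∩B {x} x∈ with x∈p∩q⁻ C _ x∈
    ... | x∈C , x∈B = x∈p∩q⁺ (decidable-stable (x ∈? S) x∈S , x∈B)
      where
      x∈S : ¬ x ∉ S
      x∈S x∉S = f∉C (closure-saturates-block cl x∈C x∉S
                       (trans (∈-Block⁻ block f∈B) (sym (∈-Block⁻ block x∈B))))

  isFlat-∉geo⇒isColoop : ∀ {F G e} → IsFlat M F → IsGeoPart block F G → e ∈ F → e ∉ G →
                          IsColoop M F e
  isFlat-∉geo⇒isColoop {F} {G} {e} F-flat geo e∈F e∉G with ∉geo⇒∃∉-in-block geo e∉G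
  ... | f , bf≡be , f∉F = isFlat-remove⇒isColoop M F-e-flat e∈F
    where
    γF-flat : IsFlat M (act (transpose e f) F)
    γF-flat = multisym (transpose e f) (transpose-InΓ block (sym bf≡be)) F F-flat
    F-e-flat : IsFlat M (F - e)
    F-e-flat = subst (IsFlat M) (∩-act-transpose e∈F f∉F) (∩-isFlat M F-flat γF-flat)

  rk-isFlat-geo : ∀ F G → IsFlat M F → IsGeoPart block F G → rk M F ≡ rk M G + ∣ F ─ G ∣
  rk-isFlat-geo F G F-flat geo = begin
    rk M F                  ≡⟨ cong (rk M) (p⊆q⇒q≡p∪q─p G⊆F) ⟩
    rk M (G ∪ (F ─ G))      ≡⟨ isColoops-rk-∪ M G⊆F F─G-coloops x∈p─q⇒x∉q ⟩
    rk M G + ∣ F ─ G ∣      ∎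
    where
    open ≡-Reasoning
    G⊆F : G ⊆ F
    G⊆F = geo⊆ geo
    F─G-coloops : ∀ {e} → e ∈ F ─ G → IsColoop M F e
    F─G-coloops e∈ = isFlat-∉geo⇒isColoop F-flat geo (p─q⊆p F G e∈) (x∈p─q⇒x∉q e∈)

lemma2p8 : ∀ {m n} (M : Matroid m) (block : Fin m → Fin n) →
    IsMultisymmetric M block →
    (∀ S C → IsClosure M S C → ∀ i →
       (C ∩ Block block i ≡ Block block i) ⊎ (C ∩ Block block i ≡ S ∩ Block block i))
    × (∀ F G → IsFlat M F → IsGeoPart block F G →
       rk M F ≡ rk M G + ∣ F ─ G ∣)
lemma2p8 M block multisym = closure-∩-Block M block multisym , rk-isFlat-geo M block multisym
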